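{- Suppose the precedence underlying $>_{pop}$ is admissible. If $s>_{pop}t$ and $s$ is a value, then $t$ is a proper subterm of $s$ modulo term equivalence (i.e. there is a proper subterm $t'$ of $s$ with $t'\approx t$); in particular $t$ is a value.
   Context: Terms over a finite signature $\mathcal{F}$ partitioned into defined symbols $\mathcal{D}$ and constructors $\mathcal{C}$, and variables $\mathcal{V}$. Values are variables and terms $c(v_1,\dots,v_n)$ with $c\in\mathcal{C}$ and $v_i$ values. Term equivalence $\approx$: $s\approx t$ iff $s=t$ or $s=f(s_1,\dots,s_n)$, $t=g(t_1,\dots,t_n)$, $f\sim g$ and $s_i\approx t_{\pi(i)}$ for some permutation $\pi$. A safe mapping assigns to each $f$ a set $\mathrm{safe}(f)\subseteq\{1,\dots,\mathrm{ar}(f)\}$ of safe argument positions (the rest are normal); all positions of constructors are safe. Write $f(s_1,\dots,s_k;s_{k+1},\dots,s_{k+l})$ with normal positions before the semicolon. A precedence is a preorder $\succeq$ on $\mathcal{F}$ with strict part $\succ$ and equivalence $\sim$; admissible means $f\sim g$ implies both are defined or both are constructors. Safe equivalence $\approx_s$: $s\approx_s t$ iff $s=t$, or $s=f(s_1,\dots,s_n)$, $t=g(t_1,\dots,t_n)$, $f\sim g$ and a permutation $\pi$ with $s_i\approx_s t_{\pi(i)}$ and ($i\in\mathrm{safe}(f)\iff\pi(i)\in\mathrm{safe}(g)$). $G_\downarrow=\{g\mid f\succ g$ for some $f\in G\}$; $\mathcal{T}(G',\mathcal{V})$ are terms over $G'$ and variables; $\mathrm{Fun}(s)$ is the set of symbols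 in $s$. $>_{sq}$: for $s=f(s_1,\dots,s_k;s_{k+1},\dots,s_{k+l})$, $s>_{sq}t$ iff (1) $s_i\geqslant_{sq}t$ for some $i$, with $i\leqslant k$ if $f\in\mathcal{D}$; or (2) $f\in\mathcal{D}$, $t=g(t_1,\dots,t_p)$, $f\succ g$ and $s>_{sq}t_j$ for all $j$; ${\geqslant_{sq}}={>_{sq}}\cup{\approx_s}$. $>_{pop}$: $s>_{pop}t$ iff (1) $s_i\geqslant_{pop}t$ for some $i$; or (2) $f\in\mathcal{D}$, $t=g(t_1,\dots,t_m;t_{m+1},\dots,t_{m+n})$, $f\succ g$, $s>_{sq}t_j$ for $j\leqslant m$, $s>_{pop}t_j$ for $j>m$, and $t_j\notin\mathcal{T}(\mathrm{Fun}(s)_\downarrow,\mathcal{V})$ for at most one $j>m$; or (3) $f\in\mathcal{D}$, $t=g(t_1,\dots,t_m;t_{m+1},\dots,t_{m+n})$, $f\sim g$, $\{s_1,\dots,s_k\}>^{mul}_{pop}\{t_1,\dots,t_m\}$ and $\{s_{k+1},\dots,s_{k+l}\}\geqslant^{mul}_{pop}\{t_{m+1},\dots,t_{m+n}\}$, where ${\geqslant_{pop}}={>_{pop}}\cup{\approx_s}$ and the multiset extensions are taken on multisets of $\approx_s$-classes (strict: replace a nonempty submultiset $X$ by $Y$ with each element of $Y$ below some element of $X$; weak: strict or equal). -}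

module Defs where

open import Data.Nat using (ℕ)
open import Data.Bool using (Bool; true; false; if_then_else_)
open import Data.Fin using (Fin; zero; suc)
open import Data.Vec using (Vec; []; _∷_; lookup)
open import Data.List using (List; []; _∷_; _++_)
open import Data.List.Relation.Unary.All using (All)
open import Data.List.Relation.Unary.Any using (Any)
open import Data.List.Relation.Binary.Permutation.Propositional using (_↭_)
open import Data.List.Relation.Binary.Pointwise using (Pointwise)
open import Data.Fin.Permutation using (Permutation; _⟨$⟩ʳ_)
open import Data.Product using (Σ; ∃; _×_; _,_)
open import Data.Sum using (_⊎_)
open import Relation.Nullary using (¬_)
open import Relation.Binary.PropositionalEquality using (_≡_)
open import Relation.Binary.Structures using (IsPreorder)

-- Signatures: a finite set of function symbols (Fin nSym), each with an
-- arity, partitioned into defined symbols (isDef f ≡ true) and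
-- constructors (isDef f ≡ false).

record Signature : Set where
  field
    nSym  : ℕ
    arity : Fin nSym → ℕ
    isDef : Fin nSym → Bool

  Sym : Set
  Sym = Fin nSym

open Signature public using (Sym; arity; isDef)

Var : Set
Var = ℕ

data Term (F : Signature) : Set where
  var : Var → Term F
  fun : (f : Sym F) → Vec (Term F) (arity F f) → Term F

module _ (F : Signature) where

  IsDefined : Sym F → Set
  IsDefined f = isDef F f ≡ true

  IsConstructor : Sym F → Set
  IsConstructor f = isDef F f ≡ false

  data IsValue : Term F → Set where
    var : ∀ x → IsValue (var x)
    con : ∀ {c ts} → IsConstructor c →
          (∀ i → IsValue (lookup ts i)) → IsValue (fun c ts)

  data _⊲_ : Term F → Term F → Set where
    arg   : ∀ {f ts} i → lookup ts i ⊲ fun f ts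
    inArg : ∀ {u f ts} i → u ⊲ lookup ts i → u ⊲ fun f ts

  data _∈Fun_ : Sym F → Term F → Set where
    here  : ∀ {f ts} → f ∈Fun fun f ts
    there : ∀ {g f ts} i → g ∈Fun lookup ts i → g ∈Fun fun f ts

record SafeMapping (F : Signature) : Set where
  field
    safe     : (f : Sym F) → Fin (arity F f) → Bool
    consSafe : ∀ f i → isDef F f ≡ false → safe f i ≡ true

open SafeMapping public

record Precedence (F : Signature) : Set₁ where
  field
    _≽_        : Sym F → Sym F → Set
    isPreorder : IsPreorder _≡_ _≽_

  _≻_ : Sym F → Sym F → Set
  f ≻ g = f ≽ g × ¬ (g ≽ f)

  _∼_ : Sym F → Sym F → Set
  f ∼ g = f ≽ g × g ≽ f

open Precedence public using (_≽_; _≻_; _∼_)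

Admissible : (F : Signature) → Precedence F → Set
Admissible F P = ∀ f g → _∼_ P f g → isDef F f ≡ isDef F g

module _ (F : Signature) (P : Precedence F) where

  data _≈_ : Term F → Term F → Set where
    ≈-refl : ∀ {s} → s ≈ s
    ≈-perm : ∀ {f g ss ts} → _∼_ P f g →
             (π : Permutation (arity F f) (arity F g)) →
             (∀ i → lookup ss i ≈ lookup ts (π ⟨$⟩ʳ i)) →
             fun f ss ≈ fun g ts

module _ (F : Signature) (sm : SafeMapping F) (P : Precedence F) where

  private
    sf = safe sm

  data _≈s_ : Term F → Term F → Set where
    ≈s-refl : ∀ {s} → s ≈s s
    ≈s-perm : ∀ {f g ss ts} → _∼_ P f g →
              (π : Permutation (arity F f) (arity F g)) →
              (∀ i → lookup ss i ≈s lookup ts (π ⟨$⟩ʳ i)) →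
              (∀ i → sf f i ≡ sf g (π ⟨$⟩ʳ i)) →
              fun f ss ≈s fun g ts

  argsWhere : ∀ {n} → (Fin n → Bool) → Vec (Term F) n → List (Term F)
  argsWhere p [] = []
  argsWhere p (x ∷ xs) =
    if p zero then x ∷ argsWhere (λ i → p (suc i)) xs
              else argsWhere (λ i → p (suc i)) xs

  normalArgs : (f : Sym F) → Vec (Term F) (arity F f) → List (Term F)
  normalArgs f ts = argsWhere (λ i → if sf f i then false else true) ts

  safeArgs : (f : Sym F) → Vec (Term F) (arity F f) → List (Term F)
  safeArgs f ts = argsWhere (sf f) ts

  -- equality of multisets of ≈s-classes
  _≈ₘ_ : List (Term F) → List (Term F) → Set
  M ≈ₘ N = ∃ λ L → M ↭ L × Pointwise _≈s_ L N

  MulGt : (Term F → Term F → Set) → List (Term F) → List (Term F) → Set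
  MulGt R M N = Σ (List (Term F)) λ C → Σ (List (Term F)) λ X →
                Σ (List (Term F)) λ Y →
                M ≈ₘ (C ++ X) × N ≈ₘ (C ++ Y) × ¬ (X ≡ []) ×
                All (λ y → Any (λ x → R x y) X) Y

  MulGe : (Term F → Term F → Set) → List (Term F) → List (Term F) → Set
  MulGe R M N = MulGt R M N ⊎ M ≈ₘ N

  -- t ∈ T(Fun(s)↓, V): every symbol of t is strictly below a symbol of s
  InBelow : Term F → Term F → Set
  InBelow s t = ∀ g → _∈Fun_ F g t → ∃ λ f → _∈Fun_ F f s × _≻_ P f g

  data _>sq_ : Term F → Term F → Set where
    sq1 : ∀ {f ss t} i → (IsDefined F f → sf f i ≡ false) →
          (lookup ss i >sq t ⊎ lookup ss i ≈s t) → fun f ss >sq t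
    sq2 : ∀ {f ss g ts} → IsDefined F f → _≻_ P f g →
          (∀ j → fun f ss >sq lookup ts j) → fun f ss >sq fun g ts

  data _>pop_ : Term F → Term F → Set where
    pop1 : ∀ {f ss t} i → (lookup ss i >pop t ⊎ lookup ss i ≈s t) →
           fun f ss >pop t
    pop2 : ∀ {f ss g ts} → IsDefined F f → _≻_ P f g →
           (∀ j → sf g j ≡ false → fun f ss >sq lookup ts j) →
           (∀ j → sf g j ≡ true → fun f ss >pop lookup ts j) →
           (∀ i j → sf g i ≡ true → sf g j ≡ true →
              ¬ InBelow (fun f ss) (lookup ts i) →
              ¬ InBelow (fun f ss) (lookup ts j) → i ≡ j) →
           fun f ss >pop fun g ts
    pop3 : ∀ {f ss g ts} → IsDefined F f → _∼_ P f g →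
           MulGt _>pop_ (normalArgs f ss) (normalArgs g ts) →
           MulGe _>pop_ (safeArgs f ss) (safeArgs g ts) →
           fun f ss >pop fun g ts

-- The root of a value is a constructor, while the rules pop2 and pop3 demand a
-- defined root; so s >pop t can only arise from pop1, which descends into an
-- argument and ends in a ≈s-step, i.e. t is ≈ to a proper subterm of s.
-- Subterms of values are values, and admissibility makes ≈ preserve values,
-- since it forbids relating a constructor to a defined symbol.
module Submission where

open import Defs
open import Data.Empty using (⊥)
open import Data.Product using (∃; _×_; _,_)
open import Data.Sum using (inj₁; inj₂)
open import Data.Vec using (lookup)
open import Data.Fin.Permutation using (_⟨$⟩ʳ_; _⟨$⟩ˡ_; inverseʳ)
open import Relation.Binary.PropositionalEquality using (sym; trans; subst)

module _ {F : Signature} where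

  defined⇒¬constructor : ∀ {f} → IsDefined F f → IsConstructor F f → ⊥
  defined⇒¬constructor d c with () ← trans (sym d) c

  IsValue-⊲ : ∀ {u s} → _⊲_ F u s → IsValue F s → IsValue F u
  IsValue-⊲ (arg i)       (con _ vs) = vs i
  IsValue-⊲ (inArg i u⊲s) (con _ vs) = IsValue-⊲ u⊲s (vs i)

  module _ {P : Precedence F} where

    ≈s⇒≈ : ∀ {sm s t} → _≈s_ F sm P s t → _≈_ F P s t
    ≈s⇒≈ ≈s-refl              = ≈-refl
    ≈s⇒≈ (≈s-perm f∼g π ss≈ _) = ≈-perm f∼g π (λ i → ≈s⇒≈ (ss≈ i))

    IsValue-≈ : Admissible F P → ∀ {s t} → _≈_ F P s t → IsValue F s → IsValue F t
    IsValue-≈ adm ≈-refl v = v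
    IsValue-≈ adm (≈-perm {f} {g} {ts = ts} f∼g π ss≈) (con cf vs) =
      con (trans (sym (adm f g f∼g)) cf) valueAt
      where
      valueAt : ∀ j → IsValue F (lookup ts j)
      valueAt j = subst (λ k → IsValue F (lookup ts k)) (inverseʳ π)
                        (IsValue-≈ adm (ss≈ (π ⟨$⟩ˡ j)) (vs (π ⟨$⟩ˡ j)))

    >pop-value⇒⊲≈ : ∀ {sm s t} → _>pop_ F sm P s t → IsValue F s →
                    ∃ λ t′ → _⊲_ F t′ s × _≈_ F P t′ t
    >pop-value⇒⊲≈ (pop1 i (inj₁ sᵢ>t)) (con _ vs) with >pop-value⇒⊲≈ sᵢ>t (vs i)
    ... | t′ , t′⊲sᵢ , t′≈t = t′ , inArg i t′⊲sᵢ , t′≈t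
    >pop-value⇒⊲≈ (pop1 i (inj₂ sᵢ≈t)) _ = _ , arg i , ≈s⇒≈ sᵢ≈t
    >pop-value⇒⊲≈ (pop2 d _ _ _ _) (con c _) with () ← defined⇒¬constructor d c
    >pop-value⇒⊲≈ (pop3 d _ _ _)   (con c _) with () ← defined⇒¬constructor d c

lemma3p6 : (F : Signature) (sm : SafeMapping F) (P : Precedence F) →
    Admissible F P →
    (s t : Term F) → _>pop_ F sm P s t → IsValue F s →
    (∃ λ t′ → _⊲_ F t′ s × _≈_ F P t′ t) × IsValue F t
lemma3p6 F sm P adm s t s>t vs with >pop-value⇒⊲≈ s>t vs
... | t′ , t′⊲s , t′≈t = (t′ , t′⊲s , t′≈t) , IsValue-≈ adm t′≈t (IsValue-⊲ t′⊲s vs)
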